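{- If $f\colon[0,1]\to\mathbb{R}$ has a continuous ternary modulus, then $f$ has a continuous ternary modulus $g\colon\mathbb{N}\to\{0,1,2\}^{\mathbb{N}}\to\mathbb{N}$ such that for each $k\in\mathbb{N}$: (1) $g_k$ is a continuous modulus of itself, i.e. $g_k$ is pointwise continuous and $\forall\alpha,\beta\,(\overline{\alpha}g_k(\alpha)=\overline{\beta}g_k(\alpha)\to g_k(\alpha)=g_k(\beta))$; (2) $g_k(\alpha)\le g_{k+1}(\alpha)$ for all $\alpha\in\{0,1,2\}^{\mathbb{N}}$.
   Context: The setting is constructive. Real numbers are regular sequences of rationals $\langle r_n\rangle$ with $|r_n-r_{n+1}|\le2^{ -(n+1)}$. Equality is $\langle r_n\rangle\simeq\langle q_n\rangle$ iff $\forall n\,|r_{n+1}-q_{n+1}|\le2^{ -n}$. Functions $[0,1]\to\mathbb{R}$ respect $\simeq$. For $s\in\{0,1,2\}^*$, define $N(\langle\rangle)=1$ and $N(s*\langle i\rangle)=2N(s)+(i-1)$. For $\alpha\in\{0,1,2\}^{\mathbb{N}}$, $\Phi(\alpha)=\langle2^{ -(n+1)}N(\overline{\alpha}n)\rangle_n$, where $\overline{\alpha}n$ is the initial segment of length $n$. A ternary modulus of $f$ is $g\colon\mathbb{N}\to\{0,1,2\}^{\mathbb{N}}\to\mathbb{N}$ with $\forall k\,\forall\alpha\,\forall x\in[0,1]\,(|\Phi(\alpha)-x|\le2^{ -g_k(\alpha)}\to|f(\Phi(\alpha))-f(x)|\le2^{ -k})$. It is continuous if each $g_k$ is pointwise continuous: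 $\forall\alpha\,\exists n\,\forall\beta\,(\overline{\alpha}n=\overline{\beta}n\to g_k(\alpha)=g_k(\beta))$. -}

module Defs where

open import Data.Nat as ℕ using (ℕ; zero; suc)
import Data.Nat.Properties as ℕP
open import Data.Integer as ℤ using (ℤ; +_)
import Data.Integer.Properties as ℤP
open import Data.Integer.Solver using (module +-*-Solver)
open import Data.Rational using (ℚ; _≤_; _-_; ∣_∣; -_; _/_; 0ℚ; 1ℚ; toℚᵘ)
import Data.Rational.Properties as ℚP
import Data.Rational.Unnormalised as ℚᵘ
import Data.Rational.Unnormalised.Properties as ℚᵘP
open import Data.Fin using (Fin; toℕ; zero; suc)
open import Data.List using (List; []; _∷ʳ_; foldl)
import Data.List.Properties as LP
open import Data.Product using (Σ; Σ-syntax; _×_; _,_; proj₁; proj₂)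
open import Data.Rational.Unnormalised using (ℚᵘ; mkℚᵘ; *≤*)
open import Relation.Binary.PropositionalEquality

2^≢0 : ∀ k → ℕ.NonZero (2 ℕ.^ k)
2^≢0 k = ℕP.m^n≢0 2 k

½^ : ℕ → ℚ
½^ k = (+ 1 / (2 ℕ.^ k)) {{2^≢0 k}}

record ℝ : Set where
  constructor mkℝ
  field
    seq : ℕ → ℚ
    reg : ∀ n → ∣ seq n - seq (suc n) ∣ ≤ ½^ (suc n)
open ℝ public

_≃ʳ_ : ℝ → ℝ → Set
x ≃ʳ y = ∀ n → ∣ seq x (suc n) - seq y (suc n) ∣ ≤ ½^ n

-- Bishop's operations on the underlying sequences (adapted to the
-- 2^{-n} convention):  (x - y)_n = x_{n+1} - y_{n+1},  |x|_n = |x_n|,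
-- the rational c is the constant sequence c, and x is nonnegative iff
-- x_n ≥ -2^{-n} for all n.
_-ˢ_ : (ℕ → ℚ) → (ℕ → ℚ) → (ℕ → ℚ)
(x -ˢ y) n = x (suc n) - y (suc n)

∣_∣ˢ : (ℕ → ℚ) → (ℕ → ℚ)
∣ x ∣ˢ n = ∣ x n ∣

constˢ : ℚ → (ℕ → ℚ)
constˢ c n = c

NonNegˢ : (ℕ → ℚ) → Set
NonNegˢ x = ∀ n → - ½^ n ≤ x n

_≤ʳ_ : ℝ → ℝ → Set
x ≤ʳ y = NonNegˢ (seq y -ˢ seq x)

Dist≤ : ℝ → ℝ → ℚ → Set
Dist≤ x y c = NonNegˢ (constˢ c -ˢ ∣ seq x -ˢ seq y ∣ˢ)

InUnit : ℝ → Set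
InUnit x = NonNegˢ (seq x -ˢ constˢ 0ℚ) × NonNegˢ (constˢ 1ℚ -ˢ seq x)

record I : Set where
  constructor mkI
  field
    pt   : ℝ
    inI  : InUnit pt
open I public

record Fun : Set where
  field
    app : I → ℝ
    ext : ∀ x y → pt x ≃ʳ pt y → app x ≃ʳ app y
open Fun public

𝟛ᴺ : Set
𝟛ᴺ = ℕ → Fin 3

prefix : 𝟛ᴺ → ℕ → List (Fin 3)
prefix α zero    = []
prefix α (suc n) = prefix α n ∷ʳ α n

Nstep : ℤ → Fin 3 → ℤ
Nstep m i = + 2 ℤ.* m ℤ.+ (+ toℕ i ℤ.- + 1)

N : List (Fin 3) → ℤ
N s = foldl Nstep (+ 1) s

Φseq : 𝟛ᴺ → ℕ → ℚ
Φseq α n = (N (prefix α n) / (2 ℕ.^ suc n)) {{2^≢0 (suc n)}}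

c-of : Fin 3 → ℤ
c-of i = + toℕ i ℤ.- + 1

∣c∣≤1 : ∀ i → ℤ.∣ ℤ.- c-of i ∣ ℕ.≤ 1
∣c∣≤1 zero = ℕ.s≤s ℕ.z≤n
∣c∣≤1 (suc zero) = ℕ.z≤n
∣c∣≤1 (suc (suc zero)) = ℕ.s≤s ℕ.z≤n

num-eq : ∀ a i D D2 → D2 ≡ + 2 ℤ.* D →
  a ℤ.* D2 ℤ.+ (ℤ.- Nstep a i) ℤ.* D ≡ (ℤ.- c-of i) ℤ.* D
num-eq a i D D2 refl = solve 3 (λ a c D → a :* (con (+ 2) :* D) :+ (:- (con (+ 2) :* a :+ c)) :* D := (:- c) :* D) refl a (c-of i) D
  where open +-*-Solver

core : ∀ a i d' d'' → suc d'' ≡ 2 ℕ.* suc d' →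
  ℚᵘ.∣ mkℚᵘ a d' ℚᵘ.- mkℚᵘ (Nstep a i) d'' ∣ ℚᵘ.≤ mkℚᵘ (+ 1) d'
core a i d' d'' eq = *≤* L
  where
  D = suc d'
  num = a ℤ.* + suc d'' ℤ.+ (ℤ.- Nstep a i) ℤ.* + D
  eqℤ : + suc d'' ≡ + 2 ℤ.* + D
  eqℤ = trans (cong +_ eq) (ℤP.pos-* 2 D)
  abs-num : ℤ.∣ num ∣ ≡ ℤ.∣ ℤ.- c-of i ∣ ℕ.* D
  abs-num = trans (cong ℤ.∣_∣ (num-eq a i (+ D) (+ suc d'') eqℤ)) (ℤP.abs-* (ℤ.- c-of i) (+ D))
  natL : ℤ.∣ num ∣ ℕ.* D ℕ.≤ D ℕ.* suc d''
  natL = begin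
      ℤ.∣ num ∣ ℕ.* D                ≡⟨ cong (ℕ._* D) abs-num ⟩
      ℤ.∣ ℤ.- c-of i ∣ ℕ.* D ℕ.* D    ≤⟨ ℕP.*-monoˡ-≤ D (ℕP.*-monoˡ-≤ D (∣c∣≤1 i)) ⟩
      1 ℕ.* D ℕ.* D                  ≤⟨ ℕP.*-monoʳ-≤ (1 ℕ.* D) (ℕP.≤-trans (ℕP.m≤m+n D (D ℕ.+ 0)) (ℕP.≤-reflexive (sym eq))) ⟩
      1 ℕ.* D ℕ.* suc d''            ≡⟨ cong (ℕ._* suc d'') (ℕP.*-identityˡ D) ⟩
      D ℕ.* suc d'' ∎
    where open ℕP.≤-Reasoning
  L : + ℤ.∣ num ∣ ℤ.* + D ℤ.≤ + 1 ℤ.* + (D ℕ.* suc d'')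
  L = subst₂ ℤ._≤_ (ℤP.pos-* ℤ.∣ num ∣ D) (sym (ℤP.*-identityˡ (+ (D ℕ.* suc d'')))) (ℤ.+≤+ natL)


core' : ∀ a i D D2 .{{_ : ℕ.NonZero D}} .{{_ : ℕ.NonZero D2}} → D2 ≡ 2 ℕ.* D →
  ℚᵘ.∣ (a ℚᵘ./ D) ℚᵘ.- (Nstep a i ℚᵘ./ D2) ∣ ℚᵘ.≤ (+ 1 ℚᵘ./ D)
core' a i (suc d') (suc d'') eq = core a i d' d'' eq

toU : ∀ a D .{{_ : ℕ.NonZero D}} → toℚᵘ (a / D) ℚᵘ.≃ (a ℚᵘ./ D)
toU a (suc d) = ℚP.toℚᵘ-fromℚᵘ (mkℚᵘ a d)

toU-abs-sub : ∀ x y → toℚᵘ ∣ x - y ∣ ℚᵘ.≃ ℚᵘ.∣ toℚᵘ x ℚᵘ.- toℚᵘ y ∣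
toU-abs-sub x y = ℚᵘP.≃-trans (ℚP.toℚᵘ-homo-∣-∣ (x - y))
  (ℚᵘP.∣-∣-cong (ℚᵘP.≃-trans (ℚP.toℚᵘ-homo-+ x (- y)) (ℚᵘP.+-congʳ (toℚᵘ x) (ℚP.toℚᵘ-homo‿- y))))

N-snoc : ∀ α n → N (prefix α (suc n)) ≡ Nstep (N (prefix α n)) (α n)
N-snoc α n = LP.foldl-∷ʳ Nstep (+ 1) (α n) (prefix α n)

Φreg : ∀ α n → ∣ Φseq α n - Φseq α (suc n) ∣ ≤ ½^ (suc n)
Φreg α n = ℚP.toℚᵘ-cancel-≤
  (ℚᵘP.≤-respˡ-≃ (ℚᵘP.≃-sym (toU-abs-sub (Φseq α n) (Φseq α (suc n))))
  (ℚᵘP.≤-respˡ-≃ (ℚᵘP.∣-∣-cong (ℚᵘP.+-cong (ℚᵘP.≃-sym (toU a D {{2^≢0 (suc n)}})) (ℚᵘP.-‿cong (ℚᵘP.≃-sym (toU b D2 {{2^≢0 (suc (suc n))}})))))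
  (ℚᵘP.≤-respʳ-≃ (ℚᵘP.≃-sym (toU (+ 1) D {{2^≢0 (suc n)}}))
    (subst (λ z → ℚᵘ.∣ (a ℚᵘ./ D) {{2^≢0 (suc n)}} ℚᵘ.- (z ℚᵘ./ D2) {{2^≢0 (suc (suc n))}} ∣ ℚᵘ.≤ (+ 1 ℚᵘ./ D) {{2^≢0 (suc n)}})
       (sym (N-snoc α n))
       (core' a (α n) D D2 {{2^≢0 (suc n)}} {{2^≢0 (suc (suc n))}} refl)))))
    where
    a = N (prefix α n)
    b = N (prefix α (suc n))
    D = 2 ℕ.^ suc n
    D2 = 2 ℕ.^ suc (suc n)


c-lo : ∀ i → ℤ.- (+ 1) ℤ.≤ c-of i
c-lo zero = ℤP.≤-refl
c-lo (suc zero) = ℤ.-≤+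
c-lo (suc (suc zero)) = ℤ.-≤+

c-hi : ∀ i → c-of i ℤ.≤ + 1
c-hi zero = ℤ.-≤+
c-hi (suc zero) = ℤ.+≤+ ℕ.z≤n
c-hi (suc (suc zero)) = ℤP.≤-refl

Nstep-eq : ∀ a i → Nstep a i ≡ (a ℤ.+ a) ℤ.+ c-of i
Nstep-eq a i = solve 2 (λ a c → con (+ 2) :* a :+ c := (a :+ a) :+ c) refl a (c-of i)
  where open +-*-Solver

Nstep-lo : ∀ a i → + 1 ℤ.≤ a → + 1 ℤ.≤ Nstep a i
Nstep-lo a i 1≤a = subst (+ 1 ℤ.≤_) (sym (Nstep-eq a i))
  (ℤP.+-mono-≤ {+ 2} {a ℤ.+ a} {ℤ.- (+ 1)} (ℤP.+-mono-≤ 1≤a 1≤a) (c-lo i))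

Nstep-hi : ∀ a i B → a ℤ.+ + 1 ℤ.≤ B → Nstep a i ℤ.+ + 1 ℤ.≤ + 2 ℤ.* B
Nstep-hi a i B h = begin
    Nstep a i ℤ.+ + 1                 ≡⟨ cong (ℤ._+ + 1) (Nstep-eq a i) ⟩
    (a ℤ.+ a) ℤ.+ c-of i ℤ.+ + 1      ≤⟨ ℤP.+-monoˡ-≤ (+ 1) (ℤP.+-monoʳ-≤ (a ℤ.+ a) (c-hi i)) ⟩
    (a ℤ.+ a) ℤ.+ + 1 ℤ.+ + 1         ≡⟨ solve 1 (λ a → (a :+ a) :+ con (+ 1) :+ con (+ 1) := (a :+ con (+ 1)) :+ (a :+ con (+ 1))) refl a ⟩
    (a ℤ.+ + 1) ℤ.+ (a ℤ.+ + 1)       ≤⟨ ℤP.+-mono-≤ h h ⟩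
    B ℤ.+ B                           ≡⟨ solve 1 (λ B → B :+ B := con (+ 2) :* B) refl B ⟩
    + 2 ℤ.* B ∎
  where open ℤP.≤-Reasoning
        open +-*-Solver

N-bounds : ∀ α n → (+ 1 ℤ.≤ N (prefix α n)) × (N (prefix α n) ℤ.+ + 1 ℤ.≤ + (2 ℕ.^ suc n))
N-bounds α zero = ℤP.≤-refl , ℤP.≤-refl
N-bounds α (suc n) =
  subst (+ 1 ℤ.≤_) (sym (N-snoc α n)) (Nstep-lo a (α n) (proj₁ ih)) ,
  subst₂ (λ z w → z ℤ.+ + 1 ℤ.≤ w) (sym (N-snoc α n)) (sym (ℤP.pos-* 2 (2 ℕ.^ suc n)))
    (Nstep-hi a (α n) (+ (2 ℕ.^ suc n)) (proj₂ ih))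
  where
    a = N (prefix α n)
    ih = N-bounds α n

0≤/ : ∀ a D .{{_ : ℕ.NonZero D}} → + 0 ℤ.≤ a → ℚᵘ.0ℚᵘ ℚᵘ.≤ (a ℚᵘ./ D)
0≤/ a (suc d) h = *≤* (subst₂ ℤ._≤_ (sym (ℤP.*-zeroˡ (+ suc d))) (sym (ℤP.*-identityʳ a)) h)

/≤1 : ∀ a D .{{_ : ℕ.NonZero D}} → a ℤ.≤ + D → (a ℚᵘ./ D) ℚᵘ.≤ ℚᵘ.1ℚᵘ
/≤1 a (suc d) h = *≤* (subst₂ ℤ._≤_ (sym (ℤP.*-identityʳ a)) (sym (ℤP.*-identityˡ (+ suc d))) h)

0≤½^ : ∀ n → 0ℚ ≤ ½^ n
0≤½^ n = ℚP.toℚᵘ-cancel-≤ (ℚᵘP.≤-respʳ-≃ (ℚᵘP.≃-sym (toU (+ 1) (2 ℕ.^ n) {{2^≢0 n}}))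
  (0≤/ (+ 1) (2 ℕ.^ n) {{2^≢0 n}} (ℤ.+≤+ ℕ.z≤n)))

-½^≤0 : ∀ n → - ½^ n ≤ 0ℚ
-½^≤0 n = ℚP.neg-antimono-≤ (0≤½^ n)

0≤Φ : ∀ α n → 0ℚ ≤ Φseq α n
0≤Φ α n = ℚP.toℚᵘ-cancel-≤ (ℚᵘP.≤-respʳ-≃ (ℚᵘP.≃-sym (toU (N (prefix α n)) (2 ℕ.^ suc n) {{2^≢0 (suc n)}}))
  (0≤/ (N (prefix α n)) (2 ℕ.^ suc n) {{2^≢0 (suc n)}} (ℤP.≤-trans (ℤ.+≤+ ℕ.z≤n) (proj₁ (N-bounds α n)))))

Φ≤1 : ∀ α n → Φseq α n ≤ 1ℚ
Φ≤1 α n = ℚP.toℚᵘ-cancel-≤ (ℚᵘP.≤-respˡ-≃ (ℚᵘP.≃-sym (toU (N (prefix α n)) (2 ℕ.^ suc n) {{2^≢0 (suc n)}}))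
  (/≤1 (N (prefix α n)) (2 ℕ.^ suc n) {{2^≢0 (suc n)}} (ℤP.≤-trans (ℤP.i≤i+j (N (prefix α n)) (+ 1)) (proj₂ (N-bounds α n)))))

ΦinI : ∀ α → InUnit (mkℝ (Φseq α) (Φreg α))
ΦinI α = lo , hi
  where
    lo : ∀ n → - ½^ n ≤ Φseq α (suc n) - 0ℚ
    lo n = ℚP.≤-trans (-½^≤0 n) (subst (0ℚ ≤_) (sym (ℚP.+-identityʳ (Φseq α (suc n)))) (0≤Φ α (suc n)))
    hi : ∀ n → - ½^ n ≤ 1ℚ - Φseq α (suc n)
    hi n = ℚP.≤-trans (-½^≤0 n) (subst (_≤ 1ℚ - Φseq α (suc n)) (ℚP.+-inverseʳ 1ℚ)
                   (ℚP.+-monoʳ-≤ 1ℚ (ℚP.neg-antimono-≤ (Φ≤1 α (suc n)))))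

Φ : 𝟛ᴺ → ℝ
Φ α = mkℝ (Φseq α) (Φreg α)

Φᴵ : 𝟛ᴺ → I
Φᴵ α = mkI (Φ α) (ΦinI α)

IsTernaryModulus : Fun → (ℕ → 𝟛ᴺ → ℕ) → Set
IsTernaryModulus f g =
  ∀ k (α : 𝟛ᴺ) (x : I) → Dist≤ (Φ α) (pt x) (½^ (g k α)) → Dist≤ (app f (Φᴵ α)) (app f x) (½^ k)

PointwiseContinuous : (𝟛ᴺ → ℕ) → Set
PointwiseContinuous h = ∀ α → Σ[ n ∈ ℕ ] (∀ β → prefix α n ≡ prefix β n → h α ≡ h β)

IsContinuousTernaryModulus : Fun → (ℕ → 𝟛ᴺ → ℕ) → Set
IsContinuousTernaryModulus f g = IsTernaryModulus f g × (∀ k → PointwiseContinuous (g k))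

IsContinuousModulusOfItself : (𝟛ᴺ → ℕ) → Set
IsContinuousModulusOfItself h =
  PointwiseContinuous h × (∀ α β → prefix α (h α) ≡ prefix β (h α) → h α ≡ h β)

-- Replacing g by its running maximum G makes it monotone in k.  Pad α after its first n
-- digits with zeros and call n admissible (for k and α) when n ≥ G (k + 1) (α padded at n) + 2;
-- let g' k α be the least admissible n.  Admissibility of any n ≤ g' k α depends only on the
-- first g' k α digits of α, so g' k is its own modulus; admissibility for k + 1 implies
-- admissibility for k, so g' is monotone in k.  Finally, Φ α and Φ (α padded at n) share n
-- digits, hence lie 2^{1-n} apart, so a point within 2^{-n} of Φ α is within 2^{-G (k+1)} of
-- the padded point; applying G (k + 1) there twice bounds the f-distance by 2^{-k}.
module Submission where

open import Defs
open import Data.Nat using (ℕ; suc; _≤_)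
open import Data.Product using (Σ-syntax; _×_)

open import Data.Bool using (true; false; if_then_else_; T)
open import Data.Empty using (⊥-elim)
open import Data.Fin using (zero)
open import Data.List using (_∷ʳ_)
import Data.List.Properties as ListP
open import Data.Nat as ℕ using (zero; _<_; _⊔_; _<ᵇ_; _≤′_; ≤′-refl; ≤′-step; s≤s)
import Data.Nat.Properties as ℕP
open import Data.Integer as ℤ using (+_)
import Data.Integer.Properties as ℤP
open import Data.Rational using (ℚ; _+_; _*_; _-_; -_; ∣_∣; _/_; ½; 0ℚ; toℚᵘ) renaming (_≤_ to _≤ℚ_)
import Data.Rational.Properties as ℚP
open import Data.Rational.Solver using (module +-*-Solver)
import Data.Rational.Unnormalised as ℚᵘ
import Data.Rational.Unnormalised.Properties as ℚᵘP
open import Data.Product using (_,_; proj₁; proj₂; ∃)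
open import Data.Sum using (_⊎_; inj₁; inj₂; [_,_]′)
open import Data.Unit using (tt)
open import Relation.Binary.PropositionalEquality
open import Relation.Binary using (tri<; tri≈; tri>)
open import Relation.Nullary using (¬_; yes; no)
open import Relation.Unary using (Decidable)

open ℚP using (≤-refl; ≤-trans)

1/[2*d]≃1/d*½ : ∀ d .{{_ : ℕ.NonZero d}} →
  (+ 1 ℚᵘ./ (2 ℕ.* d)) {{ℕP.m*n≢0 2 d}} ℚᵘ.≃ (+ 1 ℚᵘ./ d) ℚᵘ.* (+ 1 ℚᵘ./ 2)
1/[2*d]≃1/d*½ (suc d) =
  ℚᵘ.*≡* (cong (+ 1 ℤ.*_) (trans (sym (ℤP.pos-* (suc d) 2)) (cong +_ (ℕP.*-comm (suc d) 2))))

½^-suc : ∀ k → ½^ (suc k) ≡ ½^ k * ½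
½^-suc k = ℚP.toℚᵘ-injective (begin
  toℚᵘ (½^ (suc k))                                      ≈⟨ toU (+ 1) (2 ℕ.^ suc k) {{2^≢0 (suc k)}} ⟩
  (+ 1 ℚᵘ./ (2 ℕ.* 2 ℕ.^ k)) {{2^≢0 (suc k)}}            ≈⟨ 1/[2*d]≃1/d*½ (2 ℕ.^ k) {{2^≢0 k}} ⟩
  (+ 1 ℚᵘ./ 2 ℕ.^ k) {{2^≢0 k}} ℚᵘ.* (+ 1 ℚᵘ./ 2)        ≈⟨ ℚᵘP.*-cong (toU (+ 1) (2 ℕ.^ k) {{2^≢0 k}}) (toU (+ 1) 2) ⟨
  toℚᵘ (½^ k) ℚᵘ.* toℚᵘ ½                                 ≈⟨ ℚP.toℚᵘ-homo-* (½^ k) ½ ⟨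
  toℚᵘ (½^ k * ½)                                         ∎)
  where open ℚᵘP.≃-Reasoning

½^-double : ∀ k → ½^ (suc k) + ½^ (suc k) ≡ ½^ k
½^-double k rewrite ½^-suc k = solve 1 (λ h → h :* con ½ :+ h :* con ½ := h) refl (½^ k)
  where open +-*-Solver

½^-suc≤ : ∀ k → ½^ (suc k) ≤ℚ ½^ k
½^-suc≤ k = begin
  ½^ (suc k)                ≡⟨ ℚP.+-identityʳ (½^ (suc k)) ⟨
  ½^ (suc k) + 0ℚ           ≤⟨ ℚP.+-monoʳ-≤ (½^ (suc k)) (0≤½^ (suc k)) ⟩
  ½^ (suc k) + ½^ (suc k)   ≡⟨ ½^-double k ⟩
  ½^ k                      ∎
  where open ℚP.≤-Reasoning

½^-antimono : ∀ {m n} → m ≤ n → ½^ n ≤ℚ ½^ m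
½^-antimono m≤n = go (ℕP.≤⇒≤′ m≤n)
  where
  go : ∀ {m n} → m ≤′ n → ½^ n ≤ℚ ½^ m
  go ≤′-refl                = ≤-refl
  go (≤′-step {n = n} m≤′n) = ≤-trans (½^-suc≤ n) (go m≤′n)

∣p-q∣≡∣q-p∣ : ∀ p q → ∣ p - q ∣ ≡ ∣ q - p ∣
∣p-q∣≡∣q-p∣ p q = trans (sym (ℚP.∣-p∣≡∣p∣ (p - q)))
  (cong ∣_∣ (solve 2 (λ p q → :- (p :- q) := q :- p) refl p q))
  where open +-*-Solver

∣p-r∣≤∣p-q∣+∣q-r∣ : ∀ p q r → ∣ p - r ∣ ≤ℚ ∣ p - q ∣ + ∣ q - r ∣
∣p-r∣≤∣p-q∣+∣q-r∣ p q r = subst (_≤ℚ ∣ p - q ∣ + ∣ q - r ∣)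
  (cong ∣_∣ (solve 3 (λ p q r → (p :- q) :+ (q :- r) := p :- r) refl p q r))
  (ℚP.∣p+q∣≤∣p∣+∣q∣ (p - q) (q - r))
  where open +-*-Solver

∣p-p∣≡0 : ∀ p → ∣ p - p ∣ ≡ 0ℚ
∣p-p∣≡0 p = cong ∣_∣ (ℚP.+-inverseʳ p)

seq-tail : (x : ℝ) → ∀ {m n} → m ≤ n → ∣ seq x m - seq x n ∣ ≤ℚ ½^ m
seq-tail x {m} {n} m≤n = begin
  dist n              ≡⟨ ℚP.+-identityʳ (dist n) ⟨
  dist n + 0ℚ         ≤⟨ ℚP.+-monoʳ-≤ (dist n) (0≤½^ n) ⟩
  dist n + ½^ n       ≤⟨ go (ℕP.≤⇒≤′ m≤n) ⟩
  ½^ m                ∎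
  where
  open ℚP.≤-Reasoning
  dist : ℕ → ℚ
  dist j = ∣ seq x m - seq x j ∣
  -- the slack ½^ n makes the statement inductive in n
  go : ∀ {n} → m ≤′ n → dist n + ½^ n ≤ℚ ½^ m
  go ≤′-refl = ℚP.≤-reflexive (trans (cong (_+ ½^ m) (∣p-p∣≡0 (seq x m))) (ℚP.+-identityˡ (½^ m)))
  go (≤′-step {n = n} m≤′n) = ≤-trans (begin
    dist (suc n) + ½^ (suc n)
      ≤⟨ ℚP.+-monoˡ-≤ (½^ (suc n)) (∣p-r∣≤∣p-q∣+∣q-r∣ (seq x m) (seq x n) (seq x (suc n))) ⟩
    dist n + ∣ seq x n - seq x (suc n) ∣ + ½^ (suc n)
      ≤⟨ ℚP.+-monoˡ-≤ (½^ (suc n)) (ℚP.+-monoʳ-≤ (dist n) (reg x n)) ⟩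
    dist n + ½^ (suc n) + ½^ (suc n)
      ≡⟨ ℚP.+-assoc (dist n) (½^ (suc n)) (½^ (suc n)) ⟩
    dist n + (½^ (suc n) + ½^ (suc n))
      ≡⟨ cong (λ e → dist n + e) (½^-double n) ⟩
    dist n + ½^ n       ∎) (go m≤′n)

-r≤p-q⇒q≤p+r : ∀ p q r → - r ≤ℚ p - q → q ≤ℚ p + r
-r≤p-q⇒q≤p+r p q r h = subst₂ _≤ℚ_
  (solve 2 (λ q r → :- r :+ (q :+ r) := q) refl q r)
  (solve 3 (λ p q r → (p :- q) :+ (q :+ r) := p :+ r) refl p q r)
  (ℚP.+-monoˡ-≤ (q + r) h)
  where open +-*-Solver

q≤p+r⇒-r≤p-q : ∀ p q r → q ≤ℚ p + r → - r ≤ℚ p - q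
q≤p+r⇒-r≤p-q p q r h = subst₂ _≤ℚ_
  (solve 2 (λ q r → q :+ (:- q :- r) := :- r) refl q r)
  (solve 3 (λ p q r → (p :+ r) :+ (:- q :- r) := p :- q) refl p q r)
  (ℚP.+-monoˡ-≤ (- q - r) h)
  where open +-*-Solver

Dist≤⇒bound : ∀ x y c → Dist≤ x y c →
  ∀ n → ∣ seq x (suc (suc n)) - seq y (suc (suc n)) ∣ ≤ℚ c + ½^ n
Dist≤⇒bound x y c d n = -r≤p-q⇒q≤p+r c _ (½^ n) (d n)

bound⇒Dist≤ : ∀ x y c →
  (∀ n → ∣ seq x (suc (suc n)) - seq y (suc (suc n)) ∣ ≤ℚ c + ½^ n) → Dist≤ x y c
bound⇒Dist≤ x y c b n = q≤p+r⇒-r≤p-q c _ (½^ n) (b n)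

Dist≤-mono : ∀ x y {c c′} → c ≤ℚ c′ → Dist≤ x y c → Dist≤ x y c′
Dist≤-mono x y {c} {c′} c≤c′ d = bound⇒Dist≤ x y c′ λ n →
  ≤-trans (Dist≤⇒bound x y c d n) (ℚP.+-monoˡ-≤ (½^ n) c≤c′)

Dist≤-sym : ∀ x y c → Dist≤ x y c → Dist≤ y x c
Dist≤-sym x y c d = bound⇒Dist≤ y x c λ n →
  subst (_≤ℚ c + ½^ n) (∣p-q∣≡∣q-p∣ (seq x (suc (suc n))) (seq y (suc (suc n)))) (Dist≤⇒bound x y c d n)

Dist≤-trans : ∀ x y z a b → Dist≤ x y a → Dist≤ y z b → Dist≤ x z (a + b)
Dist≤-trans x y z a b xy yz = bound⇒Dist≤ x z (a + b) bound
  where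
  bound : ∀ n → ∣ seq x (suc (suc n)) - seq z (suc (suc n)) ∣ ≤ℚ (a + b) + ½^ n
  bound n = begin
    ∣ xN - zN ∣                                           ≤⟨ ∣p-r∣≤∣p-q∣+∣q-r∣ xN xM zN ⟩
    ∣ xN - xM ∣ + ∣ xM - zN ∣                             ≤⟨ ℚP.+-monoʳ-≤ ∣ xN - xM ∣ (∣p-r∣≤∣p-q∣+∣q-r∣ xM yM zN) ⟩
    ∣ xN - xM ∣ + (∣ xM - yM ∣ + ∣ yM - zN ∣)             ≤⟨ ℚP.+-monoʳ-≤ ∣ xN - xM ∣
                                                               (ℚP.+-monoʳ-≤ ∣ xM - yM ∣ (∣p-r∣≤∣p-q∣+∣q-r∣ yM zM zN)) ⟩
    ∣ xN - xM ∣ + (∣ xM - yM ∣ + (∣ yM - zM ∣ + ∣ zM - zN ∣))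
      ≤⟨ ℚP.+-mono-≤ (seq-tail x N≤M)
           (ℚP.+-mono-≤ (Dist≤⇒bound x y a xy (suc (suc n)))
             (ℚP.+-mono-≤ (Dist≤⇒bound y z b yz (suc (suc n)))
               (subst (_≤ℚ h) (∣p-q∣≡∣q-p∣ zN zM) (seq-tail z N≤M)))) ⟩
    h + ((a + h) + ((b + h) + h))                          ≡⟨ solve 3 (λ a b h → h :+ ((a :+ h) :+ ((b :+ h) :+ h))
                                                                         := (a :+ b) :+ ((h :+ h) :+ (h :+ h))) refl a b h ⟩
    (a + b) + ((h + h) + (h + h))                          ≡⟨ cong (λ e → (a + b) + (e + e)) (½^-double (suc n)) ⟩
    (a + b) + (½^ (suc n) + ½^ (suc n))                    ≡⟨ cong (λ e → (a + b) + e) (½^-double n) ⟩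
    (a + b) + ½^ n                                         ∎
    where
    open ℚP.≤-Reasoning
    open +-*-Solver
    N≤M : suc (suc n) ≤ suc (suc (suc (suc n)))
    N≤M = ℕP.m≤n+m (suc (suc n)) 2
    h = ½^ (suc (suc n))
    xN = seq x (suc (suc n))
    zN = seq z (suc (suc n))
    xM = seq x (suc (suc (suc (suc n))))
    yM = seq y (suc (suc (suc (suc n))))
    zM = seq z (suc (suc (suc (suc n))))

Dist≤-trans-½^ : ∀ x y z n → Dist≤ x y (½^ (suc n)) → Dist≤ y z (½^ (suc n)) → Dist≤ x z (½^ n)
Dist≤-trans-½^ x y z n xy yz =
  subst (Dist≤ x z) (½^-double n) (Dist≤-trans x y z (½^ (suc n)) (½^ (suc n)) xy yz)

seq-agree⇒Dist≤ : (x y : ℝ) (n : ℕ) → (∀ {i} → i ≤ suc n → seq x i ≡ seq y i) → Dist≤ x y (½^ n)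
seq-agree⇒Dist≤ x y n agree = bound⇒Dist≤ x y (½^ n) λ j → ≤-trans (near-or-far j) (≤+½^ j)
  where
  ≤+½^ : ∀ j → ½^ n ≤ℚ ½^ n + ½^ j
  ≤+½^ j = subst (_≤ℚ ½^ n + ½^ j) (ℚP.+-identityʳ (½^ n)) (ℚP.+-monoʳ-≤ (½^ n) (0≤½^ j))
  near-or-far : ∀ j → ∣ seq x (suc (suc j)) - seq y (suc (suc j)) ∣ ≤ℚ ½^ n
  near-or-far j with ℕP.≤-total (suc (suc j)) (suc n)
  ... | inj₁ J≤1+n = subst (λ w → ∣ seq x (suc (suc j)) - w ∣ ≤ℚ ½^ n) (agree J≤1+n)
                       (subst (_≤ℚ ½^ n) (sym (∣p-p∣≡0 (seq x (suc (suc j))))) (0≤½^ n))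
  ... | inj₂ 1+n≤J = begin
    ∣ xJ - yJ ∣                                   ≤⟨ ∣p-r∣≤∣p-q∣+∣q-r∣ xJ (seq x (suc n)) yJ ⟩
    ∣ xJ - seq x (suc n) ∣ + ∣ seq x (suc n) - yJ ∣
      ≡⟨ cong₂ _+_ (∣p-q∣≡∣q-p∣ xJ (seq x (suc n))) (cong (λ w → ∣ w - yJ ∣) (agree ℕP.≤-refl)) ⟩
    ∣ seq x (suc n) - xJ ∣ + ∣ seq y (suc n) - yJ ∣ ≤⟨ ℚP.+-mono-≤ (seq-tail x 1+n≤J) (seq-tail y 1+n≤J) ⟩
    ½^ (suc n) + ½^ (suc n)                        ≡⟨ ½^-double n ⟩
    ½^ n                                           ∎
    where
    open ℚP.≤-Reasoning
    xJ = seq x (suc (suc j))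
    yJ = seq y (suc (suc j))

prefix-≤ : ∀ α β {i m} → i ≤ m → prefix α m ≡ prefix β m → prefix α i ≡ prefix β i
prefix-≤ α β i≤m = go (ℕP.≤⇒≤′ i≤m)
  where
  go : ∀ {i m} → i ≤′ m → prefix α m ≡ prefix β m → prefix α i ≡ prefix β i
  go ≤′-refl                eq = eq
  go (≤′-step {n = m} i≤′m) eq = go i≤′m (ListP.∷ʳ-injectiveˡ (prefix α m) (prefix β m) eq)

prefix-≡⇒≡ : ∀ α β {i n} → prefix α n ≡ prefix β n → i < n → α i ≡ β i
prefix-≡⇒≡ α β {i} eq i<n = ListP.∷ʳ-injectiveʳ (prefix α i) (prefix β i) (prefix-≤ α β i<n eq)

prefix-cong : ∀ {α β} → α ≗ β → ∀ m → prefix α m ≡ prefix β m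
prefix-cong α≗β zero    = refl
prefix-cong α≗β (suc m) = cong₂ _∷ʳ_ (prefix-cong α≗β m) (α≗β m)

PointwiseContinuous⇒cong : ∀ {h} → PointwiseContinuous h → ∀ {α β} → α ≗ β → h α ≡ h β
PointwiseContinuous⇒cong h-cont {α} α≗β = proj₂ (h-cont α) _ (prefix-cong α≗β (proj₁ (h-cont α)))

pad : 𝟛ᴺ → ℕ → 𝟛ᴺ
pad α n i = if i <ᵇ n then α i else zero

pad-< : ∀ α {n i} → i < n → pad α n i ≡ α i
pad-< α {n} {i} i<n with i <ᵇ n | ℕP.<⇒<ᵇ i<n
... | true | _ = refl

prefix-pad : ∀ α {n} i → i ≤ n → prefix (pad α n) i ≡ prefix α i
prefix-pad α zero    _   = refl
prefix-pad α (suc i) i<n = cong₂ _∷ʳ_ (prefix-pad α i (ℕP.<⇒≤ i<n)) (pad-< α i<n)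

pad-cong : ∀ α β {j n} → prefix α n ≡ prefix β n → j ≤ n → pad α j ≗ pad β j
pad-cong α β {j} eq j≤n i with i <ᵇ j in i<ᵇj
... | true  = prefix-≡⇒≡ α β eq (ℕP.≤-trans (ℕP.<ᵇ⇒< i j (subst T (sym i<ᵇj) tt)) j≤n)
... | false = refl

record Least (P : ℕ → Set) (n : ℕ) : Set where
  field
    holds   : P n
    minimal : ∀ {m} → m < n → ¬ P m
open Least

Least-unique : ∀ {P m n} → Least P m → Least P n → m ≡ n
Least-unique {m = m} {n} lm ln with ℕP.<-cmp m n
... | tri< m<n _ _ = ⊥-elim (minimal ln m<n (holds lm))
... | tri≈ _ m≡n _ = m≡n
... | tri> _ _ n<m = ⊥-elim (minimal lm n<m (holds ln))

Least-≤ : ∀ {P m n} → Least P m → P n → m ≤ n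
Least-≤ lm pn = ℕP.≮⇒≥ λ n<m → minimal lm n<m pn

Least-transfer : ∀ {P Q n} → (∀ {j} → j ≤ n → P j → Q j) → (∀ {j} → j ≤ n → Q j → P j) →
  Least P n → Least Q n
Least-transfer P⇒Q Q⇒P ln = record
  { holds   = P⇒Q ℕP.≤-refl (holds ln)
  ; minimal = λ m<n qm → minimal ln m<n (Q⇒P (ℕP.<⇒≤ m<n) qm)
  }

least-below : ∀ {P} → Decidable P → ∀ n → ∃ (Least P) ⊎ (∀ {m} → m < n → ¬ P m)
least-below P? zero = inj₂ λ ()
least-below P? (suc n) with least-below P? n
... | inj₁ found = inj₁ found
... | inj₂ none with P? n
...   | yes pn = inj₁ (n , record { holds = pn ; minimal = none })
...   | no ¬pn = inj₂ λ m<1+n → [ none , (λ { refl → ¬pn }) ]′ (ℕP.m≤n⇒m<n∨m≡n (ℕP.≤-pred m<1+n))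

least : ∀ {P} → Decidable P → ∃ P → ∃ (Least P)
least P? (n , pn) with least-below P? (suc n)
... | inj₁ found = found
... | inj₂ none  = ⊥-elim (none (ℕP.n<1+n n) pn)

⊔-continuous : ∀ {h h′} → PointwiseContinuous h → PointwiseContinuous h′ →
  PointwiseContinuous (λ α → h α ⊔ h′ α)
⊔-continuous h-cont h′-cont α = m ⊔ m′ , λ β eq →
  cong₂ _⊔_ (proj₂ (h-cont α)  β (prefix-≤ α β (ℕP.m≤m⊔n m m′) eq))
            (proj₂ (h′-cont α) β (prefix-≤ α β (ℕP.m≤n⊔m m m′) eq))
  where
  m  = proj₁ (h-cont α)
  m′ = proj₁ (h′-cont α)

runningMax : (ℕ → 𝟛ᴺ → ℕ) → ℕ → 𝟛ᴺ → ℕ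
runningMax g zero    α = g zero α
runningMax g (suc k) α = runningMax g k α ⊔ g (suc k) α

≤-runningMax : ∀ g k α → g k α ≤ runningMax g k α
≤-runningMax g zero    α = ℕP.≤-refl
≤-runningMax g (suc k) α = ℕP.m≤n⊔m (runningMax g k α) (g (suc k) α)

runningMax-mono : ∀ g k α → runningMax g k α ≤ runningMax g (suc k) α
runningMax-mono g k α = ℕP.m≤m⊔n (runningMax g k α) (g (suc k) α)

runningMax-continuous : ∀ {g} → (∀ k → PointwiseContinuous (g k)) →
  ∀ k → PointwiseContinuous (runningMax g k)
runningMax-continuous g-cont zero    = g-cont zero
runningMax-continuous g-cont (suc k) = ⊔-continuous (runningMax-continuous g-cont k) (g-cont (suc k))

IsTernaryModulus-mono : ∀ f {g g′} → (∀ k α → g k α ≤ g′ k α) →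
  IsTernaryModulus f g → IsTernaryModulus f g′
IsTernaryModulus-mono f g≤g′ g-mod k α x d =
  g-mod k α x (Dist≤-mono (Φ α) (pt x) (½^-antimono (g≤g′ k α)) d)

Φ-close : ∀ α β n → prefix α (suc n) ≡ prefix β (suc n) → Dist≤ (Φ α) (Φ β) (½^ n)
Φ-close α β n eq = seq-agree⇒Dist≤ (Φ α) (Φ β) n λ {i} i≤1+n →
  cong (λ s → (N s / (2 ℕ.^ suc i)) {{2^≢0 (suc i)}}) (prefix-≤ α β i≤1+n eq)

module SelfModulus (f : Fun) (G : ℕ → 𝟛ᴺ → ℕ) (G-modulus : IsTernaryModulus f G)
                   (G-continuous : ∀ k → PointwiseContinuous (G k))
                   (G-mono : ∀ k α → G k α ≤ G (suc k) α) where

  f-close-via-neighbour : ∀ k α γ x {n} → 2 ℕ.+ G (suc k) γ ≤ n → prefix γ n ≡ prefix α n →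
    Dist≤ (Φ α) (pt x) (½^ n) → Dist≤ (app f (Φᴵ α)) (app f x) (½^ k)
  f-close-via-neighbour k α γ x (s≤s (s≤s {n = b} G≤b)) γ≡α α~x =
    Dist≤-trans-½^ fα fγ fx k (Dist≤-sym fγ fα (½^ (suc k)) fγ~fα) fγ~fx
    where
    fα = app f (Φᴵ α)
    fγ = app f (Φᴵ γ)
    fx = app f x
    γ~α : Dist≤ (Φ γ) (Φ α) (½^ (suc b))
    γ~α = Φ-close γ α (suc b) γ≡α
    γ~x : Dist≤ (Φ γ) (pt x) (½^ b)
    γ~x = Dist≤-trans-½^ (Φ γ) (Φ α) (pt x) b γ~α
            (Dist≤-mono (Φ α) (pt x) (½^-antimono (ℕP.n≤1+n (suc b))) α~x)
    fγ~fx : Dist≤ fγ fx (½^ (suc k))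
    fγ~fx = G-modulus (suc k) γ x (Dist≤-mono (Φ γ) (pt x) (½^-antimono G≤b) γ~x)
    fγ~fα : Dist≤ fγ fα (½^ (suc k))
    fγ~fα = G-modulus (suc k) γ (Φᴵ α)
              (Dist≤-mono (Φ γ) (Φ α) (½^-antimono (ℕP.m≤n⇒m≤1+n G≤b)) γ~α)

  Admissible : ℕ → 𝟛ᴺ → ℕ → Set
  Admissible k α n = 2 ℕ.+ G (suc k) (pad α n) ≤ n

  admissible? : ∀ k α → Decidable (Admissible k α)
  admissible? k α n = 2 ℕ.+ G (suc k) (pad α n) ℕ.≤? n

  admissible-exists : ∀ k α → ∃ (Admissible k α)
  admissible-exists k α = n , subst (λ v → 2 ℕ.+ v ≤ n) G-pad≡G (ℕP.m≤n+m (2 ℕ.+ G (suc k) α) m)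
    where
    m = proj₁ (G-continuous (suc k) α)
    n = m ℕ.+ (2 ℕ.+ G (suc k) α)
    G-pad≡G : G (suc k) α ≡ G (suc k) (pad α n)
    G-pad≡G = proj₂ (G-continuous (suc k) α) (pad α n) (sym (prefix-pad α m (ℕP.m≤m+n m _)))

  selfModulus : ℕ → 𝟛ᴺ → ℕ
  selfModulus k α = proj₁ (least (admissible? k α) (admissible-exists k α))

  selfModulus-least : ∀ k α → Least (Admissible k α) (selfModulus k α)
  selfModulus-least k α = proj₂ (least (admissible? k α) (admissible-exists k α))

  selfModulus-self : ∀ k α β → prefix α (selfModulus k α) ≡ prefix β (selfModulus k α) →
    selfModulus k α ≡ selfModulus k β
  selfModulus-self k α β eq =
    Least-unique (Least-transfer α⇒β β⇒α (selfModulus-least k α)) (selfModulus-least k β)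
    where
    G-pad : ∀ {j} → j ≤ selfModulus k α → G (suc k) (pad α j) ≡ G (suc k) (pad β j)
    G-pad j≤n = PointwiseContinuous⇒cong (G-continuous (suc k)) (pad-cong α β eq j≤n)
    α⇒β : ∀ {j} → j ≤ selfModulus k α → Admissible k α j → Admissible k β j
    α⇒β {j} j≤n = subst (λ v → 2 ℕ.+ v ≤ j) (G-pad j≤n)
    β⇒α : ∀ {j} → j ≤ selfModulus k α → Admissible k β j → Admissible k α j
    β⇒α {j} j≤n = subst (λ v → 2 ℕ.+ v ≤ j) (sym (G-pad j≤n))

  selfModulus-continuous : ∀ k → PointwiseContinuous (selfModulus k)
  selfModulus-continuous k α = selfModulus k α , selfModulus-self k α

  selfModulus-mono : ∀ k α → selfModulus k α ≤ selfModulus (suc k) α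
  selfModulus-mono k α = Least-≤ (selfModulus-least k α)
    (ℕP.≤-trans (s≤s (s≤s (G-mono (suc k) _))) (holds (selfModulus-least (suc k) α)))

  selfModulus-modulus : IsTernaryModulus f selfModulus
  selfModulus-modulus k α x = f-close-via-neighbour k α (pad α n) x
    (holds (selfModulus-least k α)) (prefix-pad α n ℕP.≤-refl)
    where n = selfModulus k α

lemma6p6 : (f : Fun) → Σ[ g ∈ (ℕ → 𝟛ᴺ → ℕ) ] IsContinuousTernaryModulus f g →
    Σ[ g ∈ (ℕ → 𝟛ᴺ → ℕ) ] (IsContinuousTernaryModulus f g ×
      (∀ k → IsContinuousModulusOfItself (g k) × (∀ α → g k α ≤ g (suc k) α)))
lemma6p6 f (g , g-modulus , g-continuous) =
  selfModulus , (selfModulus-modulus , selfModulus-continuous) ,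
  λ k → (selfModulus-continuous k , selfModulus-self k) , selfModulus-mono k
  where
  open SelfModulus f (runningMax g) (IsTernaryModulus-mono f (≤-runningMax g) g-modulus)
                     (runningMax-continuous g-continuous) (runningMax-mono g)
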